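{- Let $p$ be a prime and $m>7$ an integer. Let $D_m$ be the matrix with rows indexed by integers $i$ with $p^{m-3}-p(p^3-1)p^{m-7}\le i<p^{m-3}$ and columns indexed by integers $j$ with $0\le j<p^{m-7}$, whose $(i,j)$ entry is $\binom{i+1+j}{j}-1$ reduced modulo $p$ to $\{0,1,\ldots,p-1\}$. Then the proportion of entries of $D_m$ equal to $p-1$ (i.e. the number of such entries divided by the total number of entries of $D_m$) is $1-\left(\frac{p+1}{2p}\right)^{m-7}$. -}

module Defs where

open import Data.Nat using (ℕ; zero; suc; _+_; _*_; _∸_; _^_)
open import Data.Nat.DivMod using (_%_)
open import Data.Nat.Combinatorics using (_C_)
open import Data.Nat.Properties using (_≟_)
open import Data.List using (List; upTo; map)
open import Data.Nat.ListAction using (sum)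
open import Data.Integer using (+_)
open import Data.Rational using (ℚ; _/_; 0ℚ)
open import Relation.Nullary.Decidable using (does)
open import Data.Bool using (if_then_else_)

-- ratio a b = a / b as a rational (b = 0 is a junk case, never used below)
ratio : ℕ → ℕ → ℚ
ratio a zero    = 0ℚ
ratio a (suc b) = (+ a) / suc b

rowLo : ℕ → ℕ → ℕ
rowLo p m = p ^ (m ∸ 3) ∸ p * (p ^ 3 ∸ 1) * p ^ (m ∸ 7)

rowHi : ℕ → ℕ → ℕ
rowHi p m = p ^ (m ∸ 3)

numRows : ℕ → ℕ → ℕ
numRows p m = rowHi p m ∸ rowLo p m

numCols : ℕ → ℕ → ℕ
numCols p m = p ^ (m ∸ 7)

-- (i,j) entry of D_m: binom(i+1+j, j) - 1 reduced mod p into {0,…,p-1}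
-- (binom(i+1+j,j) ≥ 1, so truncated subtraction is exact)
entry : (p : ℕ) → .{{_ : Data.Nat.NonZero p}} → ℕ → ℕ → ℕ
entry p i j = (((i + 1 + j) C j) ∸ 1) % p

countTop : (p : ℕ) → .{{_ : Data.Nat.NonZero p}} → ℕ → ℕ
countTop p m =
  sum (map (λ r → sum (map (λ j →
         if does (entry p (rowLo p m + r) j ≟ p ∸ 1) then 1 else 0)
       (upTo (numCols p m))))
     (upTo (numRows p m)))

{-# OPTIONS --safe #-}
-- An entry of D_m is p - 1 exactly when p divides binom(i+1+j, j). Writing a = i + 1, Lucas's
-- theorem shows that among the columns j < pⁿ the number with p ∤ binom(a+j, j) is the product
-- of p - aₖ over the n lowest base-p digits aₖ of a: these are the j that add to a without carry.
-- That count is pⁿ-periodic in a, so over any pⁿ consecutive rows it sums to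
-- (∑_{d<p} (p - d))ⁿ = (p(p+1)/2)ⁿ. With n = m - 7 the number of rows is c·pⁿ for
-- c = p(p³ - 1), so the proportion of entries different from p - 1 is
-- c (p(p+1)/2)ⁿ / (c pⁿ pⁿ) = ((p+1)/2p)ⁿ.
module Submission where

open import Algebra.Properties.CommutativeSemigroup as CommutativeSemigroupProperties using ()
open import Data.Bool using (if_then_else_)
import Data.Integer as ℤ
import Data.Integer.Properties as ℤ
import Data.Integer.Tactic.RingSolver as ℤ-Solver
open import Data.List using ([]; _∷_; map; upTo; applyUpTo)
open import Data.Nat
open import Data.Nat.Combinatorics using (_C_; nCk≡n!/k![n-k]!; k![n∸k]!∣n!; nCk+nC[k+1]≡[n+1]C[k+1]; k>n⇒nCk≡0; nCn≡1)
open import Data.Nat.Divisibility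
open import Data.Nat.DivMod
open import Data.Nat.ListAction using (sum)
open import Data.Nat.Primality
open import Data.Nat.Properties
open import Data.Nat.Tactic.RingSolver
open import Data.Rational using (1ℚ; _-_; toℚᵘ)
import Data.Rational as ℚ
open import Data.Rational.Properties using (toℚᵘ-injective; toℚᵘ-fromℚᵘ; toℚᵘ-homo-+; toℚᵘ-homo‿-)
open import Data.Rational.Unnormalised as ℚᵘ using (mkℚᵘ; *≡*; 1ℚᵘ)
import Data.Rational.Unnormalised.Properties as ℚᵘ
open import Data.Sum using (inj₁; inj₂; [_,_]′)
open import Function using (_∘_)
open import Relation.Binary.Definitions using (tri<; tri≈; tri>)
open import Relation.Binary.PropositionalEquality
open import Relation.Nullary using (¬_; yes; no; does; contradiction)
open import Relation.Nullary.Decidable using (dec-true; dec-false)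

open import Defs

-- The right-hand side is the numerator of 1ℚᵘ ℚᵘ.- mkℚᵘ z _ as ℚᵘ computes it.
cross-complement : ∀ (x y z w : ℤ.ℤ) → x ℤ.* w ℤ.+ z ℤ.* y ≡ w ℤ.* y →
                   x ℤ.* (ℤ.1ℤ ℤ.* w) ≡ (ℤ.1ℤ ℤ.* w ℤ.+ ℤ.- z ℤ.* ℤ.1ℤ) ℤ.* y
cross-complement x y z w eq = begin
  x ℤ.* (ℤ.1ℤ ℤ.* w)                     ≡⟨ ℤ-Solver.solve (x ∷ y ∷ z ∷ w ∷ []) ⟩
  x ℤ.* w ℤ.+ z ℤ.* y ℤ.- z ℤ.* y        ≡⟨ cong (ℤ._- z ℤ.* y) eq ⟩
  w ℤ.* y ℤ.- z ℤ.* y                    ≡⟨ ℤ-Solver.solve (x ∷ y ∷ z ∷ w ∷ []) ⟩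
  (ℤ.1ℤ ℤ.* w ℤ.+ ℤ.- z ℤ.* ℤ.1ℤ) ℤ.* y  ∎
  where open ≡-Reasoning

ratio-complement : ∀ {a b c d} → 0 < b → 0 < d → a * d + c * b ≡ d * b → ratio a b ≡ 1ℚ - ratio c d
ratio-complement {a} {suc b} {c} {suc d} _ _ a*d+c*b≡d*b = toℚᵘ-injective (begin
  toℚᵘ (ratio a (suc b))
    ≈⟨ toℚᵘ-fromℚᵘ (mkℚᵘ (ℤ.+ a) b) ⟩
  mkℚᵘ (ℤ.+ a) b
    ≈⟨ *≡* (cross-complement (ℤ.+ a) (ℤ.+ suc b) (ℤ.+ c) (ℤ.+ suc d) lifted) ⟩
  1ℚᵘ ℚᵘ.- mkℚᵘ (ℤ.+ c) d
    ≈⟨ ℚᵘ.+-congʳ 1ℚᵘ (ℚᵘ.-‿cong (toℚᵘ-fromℚᵘ (mkℚᵘ (ℤ.+ c) d))) ⟨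
  1ℚᵘ ℚᵘ.- toℚᵘ (ratio c (suc d))
    ≈⟨ ℚᵘ.+-congʳ 1ℚᵘ (toℚᵘ-homo‿- (ratio c (suc d))) ⟨
  toℚᵘ 1ℚ ℚᵘ.+ toℚᵘ (ℚ.- ratio c (suc d))
    ≈⟨ toℚᵘ-homo-+ 1ℚ (ℚ.- ratio c (suc d)) ⟨
  toℚᵘ (1ℚ - ratio c (suc d))
    ∎)
  where
  open ℚᵘ.≃-Reasoning
  lifted : ℤ.+ a ℤ.* ℤ.+ suc d ℤ.+ ℤ.+ c ℤ.* ℤ.+ suc b ≡ ℤ.+ suc d ℤ.* ℤ.+ suc b
  lifted = trans (cong₂ ℤ._+_ (sym (ℤ.pos-* a (suc d))) (sym (ℤ.pos-* c (suc b))))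
         ( trans (sym (ℤ.pos-+ (a * suc d) (c * suc b)))
         ( trans (cong ℤ.+_ a*d+c*b≡d*b) (ℤ.pos-* (suc d) (suc b))))

open ≡-Reasoning
open CommutativeSemigroupProperties +-commutativeSemigroup using ()
  renaming (interchange to +-interchange; xy∙z≈xz∙y to +-right-comm)
open CommutativeSemigroupProperties *-commutativeSemigroup using () renaming (interchange to *-interchange)

∑ : ℕ → (ℕ → ℕ) → ℕ
∑ zero    f = 0
∑ (suc n) f = f 0 + ∑ n (f ∘ suc)

syntax ∑ n (λ i → e) = ∑[ i < n ] e

sum-map-applyUpTo : ∀ (f g : ℕ → ℕ) n → sum (map f (applyUpTo g n)) ≡ ∑[ i < n ] f (g i)
sum-map-applyUpTo f g zero    = refl
sum-map-applyUpTo f g (suc n) = cong (f (g 0) +_) (sum-map-applyUpTo f (g ∘ suc) n)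

sum-map-upTo : ∀ (f : ℕ → ℕ) n → sum (map f (upTo n)) ≡ ∑ n f
sum-map-upTo f = sum-map-applyUpTo f (λ i → i)

∑-cong : ∀ n {f g : ℕ → ℕ} → (∀ i → i < n → f i ≡ g i) → ∑ n f ≡ ∑ n g
∑-cong zero    f≗g = refl
∑-cong (suc n) f≗g = cong₂ _+_ (f≗g 0 z<s) (∑-cong n (λ i i<n → f≗g (suc i) (s<s i<n)))

∑-const : ∀ n c → ∑[ _ < n ] c ≡ n * c
∑-const zero    c = refl
∑-const (suc n) c = cong (c +_) (∑-const n c)

∑-distrib-+ : ∀ n (f g : ℕ → ℕ) → ∑[ i < n ] (f i + g i) ≡ ∑ n f + ∑ n g
∑-distrib-+ zero    f g = refl
∑-distrib-+ (suc n) f g = begin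
  f 0 + g 0 + ∑[ i < n ] (f (suc i) + g (suc i))   ≡⟨ cong (f 0 + g 0 +_) (∑-distrib-+ n (f ∘ suc) (g ∘ suc)) ⟩
  f 0 + g 0 + (∑ n (f ∘ suc) + ∑ n (g ∘ suc))     ≡⟨ +-interchange (f 0) (g 0) _ _ ⟩
  f 0 + ∑ n (f ∘ suc) + (g 0 + ∑ n (g ∘ suc))     ∎

∑-*ˡ : ∀ n c (f : ℕ → ℕ) → ∑[ i < n ] (c * f i) ≡ c * ∑ n f
∑-*ˡ zero    c f = sym (*-zeroʳ c)
∑-*ˡ (suc n) c f = trans (cong (c * f 0 +_) (∑-*ˡ n c (f ∘ suc))) (sym (*-distribˡ-+ c (f 0) _))

∑-*ʳ : ∀ n c (f : ℕ → ℕ) → ∑[ i < n ] (f i * c) ≡ ∑ n f * c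
∑-*ʳ zero    c f = refl
∑-*ʳ (suc n) c f = trans (cong (f 0 * c +_) (∑-*ʳ n c (f ∘ suc))) (sym (*-distribʳ-+ c (f 0) _))

∑-+ : ∀ m n (f : ℕ → ℕ) → ∑ (m + n) f ≡ ∑ m f + ∑[ i < n ] f (m + i)
∑-+ zero    n f = refl
∑-+ (suc m) n f = trans (cong (f 0 +_) (∑-+ m n (f ∘ suc))) (sym (+-assoc (f 0) _ _))

∑-suc : ∀ n (f : ℕ → ℕ) → ∑ (suc n) f ≡ ∑ n f + f n
∑-suc n f = begin
  ∑ (suc n) f                ≡⟨ cong (λ m → ∑ m f) (+-comm 1 n) ⟩
  ∑ (n + 1) f                ≡⟨ ∑-+ n 1 f ⟩
  ∑ n f + (f (n + 0) + 0)    ≡⟨ cong (∑ n f +_) (trans (+-identityʳ _) (cong f (+-identityʳ n))) ⟩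
  ∑ n f + f n                ∎

∑-* : ∀ m n (f : ℕ → ℕ) → ∑ (m * n) f ≡ ∑[ q < m ] ∑[ r < n ] f (q * n + r)
∑-* zero    n f = refl
∑-* (suc m) n f = begin
  ∑ (n + m * n) f                                       ≡⟨ ∑-+ n (m * n) f ⟩
  ∑ n f + ∑[ i < m * n ] f (n + i)                      ≡⟨ cong (∑ n f +_) (∑-* m n (λ i → f (n + i))) ⟩
  ∑ n f + ∑[ q < m ] ∑[ r < n ] f (n + (q * n + r))     ≡⟨ cong (∑ n f +_) (∑-cong m (λ q _ → ∑-cong n (λ r _ →
                                                              cong f (sym (+-assoc n (q * n) r))))) ⟩
  ∑ n f + ∑[ q < m ] ∑[ r < n ] f (n + q * n + r)       ∎

∑-prefix-const : ∀ {t n c} (f : ℕ → ℕ) → t ≤ n →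
                 (∀ r → r < t → f r ≡ c) → (∀ r → t ≤ r → r < n → f r ≡ 0) → ∑ n f ≡ t * c
∑-prefix-const {t} {n} {c} f t≤n prefix suffix = begin
  ∑ n f                                  ≡⟨ cong (λ m → ∑ m f) (m+[n∸m]≡n t≤n) ⟨
  ∑ (t + (n ∸ t)) f                      ≡⟨ ∑-+ t (n ∸ t) f ⟩
  ∑ t f + ∑[ i < n ∸ t ] f (t + i)       ≡⟨ cong₂ _+_ (∑-cong t prefix) (∑-cong (n ∸ t) suffix′) ⟩
  ∑[ _ < t ] c + ∑[ _ < n ∸ t ] 0        ≡⟨ cong₂ _+_ (∑-const t c) (∑-const (n ∸ t) 0) ⟩
  t * c + (n ∸ t) * 0                    ≡⟨ cong (t * c +_) (*-zeroʳ (n ∸ t)) ⟩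
  t * c + 0                              ≡⟨ +-identityʳ (t * c) ⟩
  t * c                                  ∎
  where
  suffix′ : ∀ i → i < n ∸ t → f (t + i) ≡ 0
  suffix′ i i<n∸t = suffix (t + i) (m≤m+n t i) (subst (t + i <_) (m+[n∸m]≡n t≤n) (+-monoʳ-< t i<n∸t))

∑-periodic-shift : ∀ P (f : ℕ → ℕ) → (∀ x → f (x + P) ≡ f x) → ∀ a → ∑[ r < P ] f (a + r) ≡ ∑ P f
∑-periodic-shift P f periodic zero    = refl
∑-periodic-shift P f periodic (suc a) = begin
  ∑[ r < P ] f (suc a + r)        ≡⟨ ∑-cong P (λ r _ → cong f (sym (+-suc a r))) ⟩
  ∑[ r < P ] F (suc r)            ≡⟨ +-cancelˡ-≡ (F 0) _ _ rotate ⟩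
  ∑ P F                           ≡⟨ ∑-periodic-shift P f periodic a ⟩
  ∑ P f                           ∎
  where
  F : ℕ → ℕ
  F r = f (a + r)
  rotate : F 0 + ∑[ r < P ] F (suc r) ≡ F 0 + ∑ P F
  rotate = begin
    ∑ (suc P) F       ≡⟨ ∑-suc P F ⟩
    ∑ P F + F P       ≡⟨ cong (∑ P F +_) (trans (periodic a) (cong f (sym (+-identityʳ a)))) ⟩
    ∑ P F + F 0       ≡⟨ +-comm (∑ P F) (F 0) ⟩
    F 0 + ∑ P F       ∎

∑-periodic-window : ∀ c P (f : ℕ → ℕ) → (∀ x → f (x + P) ≡ f x) → ∀ a →
                    ∑[ r < c * P ] f (a + r) ≡ c * ∑ P f
∑-periodic-window c P f periodic a = begin
  ∑[ r < c * P ] f (a + r)                   ≡⟨ ∑-* c P (λ r → f (a + r)) ⟩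
  ∑[ q < c ] ∑[ r < P ] f (a + (q * P + r))  ≡⟨ ∑-cong c (λ q _ → trans
                                                  (∑-cong P (λ r _ → cong f (sym (+-assoc a (q * P) r))))
                                                  (∑-periodic-shift P f periodic (a + q * P))) ⟩
  ∑[ _ < c ] ∑ P f                           ≡⟨ ∑-const c (∑ P f) ⟩
  c * ∑ P f                                  ∎

2*∑[n∸i]≡n*[n+1] : ∀ n → 2 * ∑[ i < n ] (n ∸ i) ≡ n * (n + 1)
2*∑[n∸i]≡n*[n+1] zero    = refl
2*∑[n∸i]≡n*[n+1] (suc n) = begin
  2 * (suc n + ∑[ i < n ] (n ∸ i))         ≡⟨ *-distribˡ-+ 2 (suc n) _ ⟩
  2 * suc n + 2 * ∑[ i < n ] (n ∸ i)       ≡⟨ cong (2 * suc n +_) (2*∑[n∸i]≡n*[n+1] n) ⟩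
  2 * suc n + n * (n + 1)                  ≡⟨ solve (n ∷ []) ⟩
  suc n * (suc n + 1)                      ∎

[m*n]^o≡m^o*n^o : ∀ m n o → (m * n) ^ o ≡ m ^ o * n ^ o
[m*n]^o≡m^o*n^o m n zero    = refl
[m*n]^o≡m^o*n^o m n (suc o) = begin
  m * n * (m * n) ^ o              ≡⟨ cong (m * n *_) ([m*n]^o≡m^o*n^o m n o) ⟩
  m * n * (m ^ o * n ^ o)          ≡⟨ *-interchange m n (m ^ o) (n ^ o) ⟩
  m * m ^ o * (n * n ^ o)          ∎

nCk*k![n∸k]!≡n! : ∀ {n k} → k ≤ n → (n C k) * (k ! * (n ∸ k) !) ≡ n !
nCk*k![n∸k]!≡n! {n} {k} k≤n = begin
  (n C k) * (k ! * (n ∸ k) !)                 ≡⟨ cong (_* (k ! * (n ∸ k) !)) (nCk≡n!/k![n-k]! k≤n) ⟩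
  n ! / (k ! * (n ∸ k) !) * (k ! * (n ∸ k) !) ≡⟨ m/n*n≡m (k![n∸k]!∣n! k≤n) ⟩
  n !                                         ∎
  where instance _ = k !* (n ∸ k) !≢0

nCk>0 : ∀ {n k} → k ≤ n → 0 < n C k
nCk>0 {n} {k} k≤n with n C k | nCk*k![n∸k]!≡n! k≤n
... | zero  | 0≡n! = contradiction (sym 0≡n!) (≢-nonZero⁻¹ (n !) {{n !≢0}})
... | suc _ | _    = z<s

[1+m]*n+o≡m*n+o+n : ∀ m n o → suc m * n + o ≡ m * n + o + n
[1+m]*n+o≡m*n+o+n = solve-∀

m%n≡n∸1⇒[1+m]%n≡0 : ∀ m n .{{_ : NonZero n}} → m % n ≡ n ∸ 1 → suc m % n ≡ 0
m%n≡n∸1⇒[1+m]%n≡0 m n m%n≡n∸1 = begin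
  suc m % n                        ≡⟨ cong (λ k → suc k % n) (m≡m%n+[m/n]*n m n) ⟩
  (suc (m % n) + m / n * n) % n    ≡⟨ [m+kn]%n≡m%n (suc (m % n)) (m / n) n ⟩
  suc (m % n) % n                  ≡⟨ cong (λ k → suc k % n) m%n≡n∸1 ⟩
  suc (n ∸ 1) % n                  ≡⟨ cong (_% n) (suc-pred n) ⟩
  n % n                            ≡⟨ n%n≡0 n ⟩
  0                                ∎

n∣n! : ∀ n .{{_ : NonZero n}} → n ∣ n !
n∣n! (suc n) = m∣m*n (n !)

module PrimeModulus {p : ℕ} (prime : Prime p) where

  instance
    p≢0 : NonZero p
    p≢0 = prime⇒nonZero prime

  1<p : 1 < p
  1<p = nonTrivial⇒n>1 p {{prime⇒nonTrivial prime}}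

  infix 4 _≡ₚ_
  _≡ₚ_ : ℕ → ℕ → Set
  x ≡ₚ y = x % p ≡ y % p

  +-cong-≡ₚ : ∀ {x x′ y y′} → x ≡ₚ x′ → y ≡ₚ y′ → x + y ≡ₚ x′ + y′
  +-cong-≡ₚ {x} {x′} {y} {y′} x≡x′ y≡y′ = begin
    (x + y) % p               ≡⟨ %-distribˡ-+ x y p ⟩
    (x % p + y % p) % p       ≡⟨ cong₂ (λ u v → (u + v) % p) x≡x′ y≡y′ ⟩
    (x′ % p + y′ % p) % p     ≡⟨ %-distribˡ-+ x′ y′ p ⟨
    (x′ + y′) % p             ∎

  ∣⇒≡ₚ0 : ∀ {x} → p ∣ x → x ≡ₚ 0
  ∣⇒≡ₚ0 {x} p∣x = trans (n∣m⇒m%n≡0 x p p∣x) (sym (n∣m⇒m%n≡0 0 p (p ∣0)))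

  p∤m*n : ∀ {m n} → ¬ p ∣ m → ¬ p ∣ n → ¬ p ∣ m * n
  p∤m*n {m} {n} p∤m p∤n = [ p∤m , p∤n ]′ ∘ euclidsLemma m n prime

  p∤1 : ¬ p ∣ 1
  p∤1 p∣1 = <⇒≢ 1<p (sym (∣1⇒≡1 p∣1))

  p∤k! : ∀ k → k < p → ¬ p ∣ k !
  p∤k! zero    _   = p∤1
  p∤k! (suc k) k<p = p∤m*n (λ p∣k+1 → <⇒≱ k<p (∣⇒≤ p∣k+1)) (p∤k! k (<-trans (n<1+n k) k<p))

  p∣pCk : ∀ {k} → 0 < k → k < p → p ∣ p C k
  p∣pCk {k} 0<k k<p
    with euclidsLemma (p C k) (k ! * (p ∸ k) !) prime (subst (p ∣_) (sym (nCk*k![n∸k]!≡n! (<⇒≤ k<p))) (n∣n! p))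
  ... | inj₁ p∣pCk       = p∣pCk
  ... | inj₂ p∣k![p∸k]! = contradiction p∣k![p∸k]!
                            (p∤m*n (p∤k! k k<p) (p∤k! (p ∸ k) (∸-monoʳ-< 0<k (<⇒≤ k<p))))

  p∤nCk : ∀ {n k} → k ≤ n → n < p → ¬ p ∣ n C k
  p∤nCk {n} {k} k≤n n<p p∣nCk =
    p∤k! n n<p (subst (p ∣_) (nCk*k![n∸k]!≡n! k≤n) (∣m⇒∣m*n (k ! * (n ∸ k) !) p∣nCk))

  -- shiftedC t n k is the coefficient of xᵏ in xᵗ (1 + x)ⁿ.
  shiftedC : ℕ → ℕ → ℕ → ℕ
  shiftedC zero    n k       = n C k
  shiftedC (suc t) n zero    = 0
  shiftedC (suc t) n (suc k) = shiftedC t n k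

  shiftedC-< : ∀ {t n k} → k < t → shiftedC t n k ≡ 0
  shiftedC-< {suc t} {n} {zero}  _       = refl
  shiftedC-< {suc t} {n} {suc k} (s<s k<t) = shiftedC-< {t} {n} k<t

  shiftedC-+ : ∀ t n k → shiftedC t n (k + t) ≡ n C k
  shiftedC-+ zero    n k = cong (n C_) (+-identityʳ k)
  shiftedC-+ (suc t) n k = trans (cong (shiftedC (suc t) n) (+-suc k t)) (shiftedC-+ t n k)

  shiftedC-pascal : ∀ t n k → shiftedC t (suc n) (suc k) ≡ shiftedC t n k + shiftedC t n (suc k)
  shiftedC-pascal zero          n k       = sym (nCk+nC[k+1]≡[n+1]C[k+1] n k)
  shiftedC-pascal (suc zero)    n zero    = refl
  shiftedC-pascal (suc (suc t)) n zero    = refl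
  shiftedC-pascal (suc t)       n (suc k) = shiftedC-pascal t n k

  -- (1 + x)ⁿ⁺ᵖ ≡ (1 + x)ⁿ (1 + xᵖ) modulo p, read off coefficientwise.
  C-+p : ∀ n k → (n + p) C k ≡ₚ n C k + shiftedC p n k
  C-+p n       zero    = cong (λ s → (1 + s) % p) (sym (shiftedC-< {p} {n} (<-trans z<s 1<p)))
  C-+p zero    (suc k) with <-cmp (suc k) p
  ... | tri< k<p _ _  = trans (∣⇒≡ₚ0 (p∣pCk z<s k<p)) (cong (_% p) (sym (shiftedC-< {p} {0} k<p)))
  ... | tri≈ _ refl _ = cong (_% p) (trans (nCn≡1 p) (sym (shiftedC-+ p 0 0)))
  ... | tri> _ _ k>p  = cong (_% p) (begin
    p C suc k                            ≡⟨ k>n⇒nCk≡0 k>p ⟩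
    0                                    ≡⟨ k>n⇒nCk≡0 (m<n⇒0<n∸m k>p) ⟨
    0 C (suc k ∸ p)                      ≡⟨ shiftedC-+ p 0 (suc k ∸ p) ⟨
    shiftedC p 0 (suc k ∸ p + p)         ≡⟨ cong (shiftedC p 0) (m∸n+n≡m (<⇒≤ k>p)) ⟩
    shiftedC p 0 (suc k)                 ∎)
  C-+p (suc n) (suc k) = begin
    ((suc n + p) C suc k) % p
      ≡⟨ cong (_% p) (nCk+nC[k+1]≡[n+1]C[k+1] (n + p) k) ⟨
    ((n + p) C k + (n + p) C suc k) % p
      ≡⟨ +-cong-≡ₚ (C-+p n k) (C-+p n (suc k)) ⟩
    (n C k + shiftedC p n k + (n C suc k + shiftedC p n (suc k))) % p
      ≡⟨ cong (_% p) (+-interchange (n C k) _ _ _) ⟩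
    (n C k + n C suc k + (shiftedC p n k + shiftedC p n (suc k))) % p
      ≡⟨ cong (_% p) (cong₂ _+_ (nCk+nC[k+1]≡[n+1]C[k+1] n k) (sym (shiftedC-pascal p n k))) ⟩
    (suc n C suc k + shiftedC p (suc n) (suc k)) % p
      ∎

  lucas : ∀ N K {a b} → a < p → b < p → (N * p + a) C (K * p + b) ≡ₚ (N C K) * (a C b)
  lucas zero    zero    {a} {b} _   _ = cong (_% p) (sym (*-identityˡ (a C b)))
  lucas zero    (suc K) {a} {b} a<p _ =
    cong (_% p) (k>n⇒nCk≡0 (<-≤-trans a<p (≤-trans (m≤m+n p (K * p)) (m≤m+n _ b))))
  lucas (suc N) K {a} {b} a<p b<p = begin
    ((suc N * p + a) C (K * p + b)) % p
      ≡⟨ cong (λ n → (n C (K * p + b)) % p) ([1+m]*n+o≡m*n+o+n N p a) ⟩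
    ((X + p) C (K * p + b)) % p
      ≡⟨ C-+p X (K * p + b) ⟩
    (X C (K * p + b) + shiftedC p X (K * p + b)) % p
      ≡⟨ after-frobenius K ⟩
    ((suc N C K) * (a C b)) % p
      ∎
    where
    X : ℕ
    X = N * p + a
    shiftedC-X : ∀ K → shiftedC p X (suc K * p + b) ≡ X C (K * p + b)
    shiftedC-X K = trans (cong (shiftedC p X) ([1+m]*n+o≡m*n+o+n K p b)) (shiftedC-+ p X (K * p + b))
    after-frobenius : ∀ K → (X C (K * p + b) + shiftedC p X (K * p + b)) % p ≡ ((suc N C K) * (a C b)) % p
    after-frobenius zero    = begin
      (X C b + shiftedC p X b) % p                       ≡⟨ cong (λ s → (X C b + s) % p) (shiftedC-< b<p) ⟩
      (X C b + 0) % p                                    ≡⟨ cong (_% p) (+-identityʳ (X C b)) ⟩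
      (X C b) % p                                        ≡⟨ lucas N zero a<p b<p ⟩
      ((N C 0) * (a C b)) % p                            ∎
    after-frobenius (suc K) = begin
      (X C (suc K * p + b) + shiftedC p X (suc K * p + b)) % p
        ≡⟨ cong (λ s → (X C (suc K * p + b) + s) % p) (shiftedC-X K) ⟩
      (X C (suc K * p + b) + X C (K * p + b)) % p
        ≡⟨ +-cong-≡ₚ (lucas N (suc K) a<p b<p) (lucas N K a<p b<p) ⟩
      ((N C suc K) * (a C b) + (N C K) * (a C b)) % p
        ≡⟨ cong (_% p) (*-distribʳ-+ (a C b) (N C suc K) (N C K)) ⟨
      ((N C suc K + N C K) * (a C b)) % p
        ≡⟨ cong (λ c → (c * (a C b)) % p) (trans (+-comm (N C suc K) (N C K)) (nCk+nC[k+1]≡[n+1]C[k+1] N K)) ⟩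
      ((suc N C suc K) * (a C b)) % p
        ∎

  [p∤_] : ℕ → ℕ
  [p∤ x ] = if does (x % p ≟ 0) then 0 else 1

  [p∤]-cong : ∀ {x y} → x ≡ₚ y → [p∤ x ] ≡ [p∤ y ]
  [p∤]-cong = cong (λ r → if does (r ≟ 0) then 0 else 1)

  [p∤]-∣ : ∀ {x} → p ∣ x → [p∤ x ] ≡ 0
  [p∤]-∣ {x} p∣x rewrite n∣m⇒m%n≡0 x p p∣x = refl

  [p∤]-∤ : ∀ {x} → ¬ p ∣ x → [p∤ x ] ≡ 1
  [p∤]-∤ {x} p∤x with x % p in x%p≡r
  ... | zero  = contradiction (m%n≡0⇒n∣m x p x%p≡r) p∤x
  ... | suc _ = refl

  [p∤]-*-∤ : ∀ x {y} → ¬ p ∣ y → [p∤ x * y ] ≡ [p∤ x ]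
  [p∤]-*-∤ x {y} p∤y with p ∣? x
  ... | yes p∣x = trans ([p∤]-∣ (∣m⇒∣m*n y p∣x)) (sym ([p∤]-∣ p∣x))
  ... | no  p∤x = trans ([p∤]-∤ (p∤m*n p∤x p∤y)) (sym ([p∤]-∤ p∤x))

  [p∤C]-no-carry : ∀ A Q {a r} → a + r < p → [p∤ (A * p + (a + r)) C (Q * p + r) ] ≡ [p∤ A C Q ]
  [p∤C]-no-carry A Q {a} {r} a+r<p = begin
    [p∤ (A * p + (a + r)) C (Q * p + r) ]   ≡⟨ [p∤]-cong (lucas A Q a+r<p (≤-<-trans (m≤n+m r a) a+r<p)) ⟩
    [p∤ (A C Q) * ((a + r) C r) ]           ≡⟨ [p∤]-*-∤ (A C Q) (p∤nCk (m≤n+m r a) a+r<p) ⟩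
    [p∤ A C Q ]                             ∎

  [p∤C]-carry : ∀ A Q {a r} → a < p → r < p → p ≤ a + r → [p∤ (A * p + (a + r)) C (Q * p + r) ] ≡ 0
  [p∤C]-carry A Q {a} {r} a<p r<p p≤a+r = begin
    [p∤ (A * p + (a + r)) C (Q * p + r) ]   ≡⟨ cong (λ n → [p∤ n C (Q * p + r) ]) borrow ⟩
    [p∤ (suc A * p + s) C (Q * p + r) ]     ≡⟨ [p∤]-cong (lucas (suc A) Q s<p r<p) ⟩
    [p∤ (suc A C Q) * (s C r) ]             ≡⟨ cong (λ c → [p∤ (suc A C Q) * c ]) (k>n⇒nCk≡0 s<r) ⟩
    [p∤ (suc A C Q) * 0 ]                   ≡⟨ cong [p∤_] (*-zeroʳ (suc A C Q)) ⟩
    [p∤ 0 ]                                 ≡⟨ [p∤]-∣ (p ∣0) ⟩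
    0                                       ∎
    where
    s : ℕ
    s = a + r ∸ p
    s+p≡a+r : s + p ≡ a + r
    s+p≡a+r = m∸n+n≡m p≤a+r
    s<r : s < r
    s<r = +-cancelʳ-< p s r (subst (_< r + p) (sym s+p≡a+r) (subst (a + r <_) (+-comm p r) (+-monoˡ-< r a<p)))
    s<p : s < p
    s<p = <-trans s<r r<p
    borrow : A * p + (a + r) ≡ suc A * p + s
    borrow = begin
      A * p + (a + r)   ≡⟨ cong (A * p +_) s+p≡a+r ⟨
      A * p + (s + p)   ≡⟨ +-assoc (A * p) s p ⟨
      A * p + s + p     ≡⟨ [1+m]*n+o≡m*n+o+n A p s ⟨
      suc A * p + s     ∎

  nonzeroCount : ℕ → ℕ → ℕ
  nonzeroCount n a = ∑[ j < p ^ n ] [p∤ (a + j) C j ]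

  nonzeroCount-digit : ∀ n A {a} → a < p → nonzeroCount (suc n) (A * p + a) ≡ (p ∸ a) * nonzeroCount n A
  nonzeroCount-digit n A {a} a<p = begin
    ∑ (p * p ^ n) F                                    ≡⟨ cong (λ m → ∑ m F) (*-comm p (p ^ n)) ⟩
    ∑ (p ^ n * p) F                                    ≡⟨ ∑-* (p ^ n) p F ⟩
    ∑[ q < p ^ n ] ∑[ r < p ] F (q * p + r)            ≡⟨ ∑-cong (p ^ n) (λ q _ → column q) ⟩
    ∑[ q < p ^ n ] ((p ∸ a) * [p∤ (A + q) C q ])      ≡⟨ ∑-*ˡ (p ^ n) (p ∸ a) (λ q → [p∤ (A + q) C q ]) ⟩
    (p ∸ a) * nonzeroCount n A                         ∎
    where
    F : ℕ → ℕ
    F j = [p∤ (A * p + a + j) C j ]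
    regroup : ∀ q r → A * p + a + (q * p + r) ≡ (A + q) * p + (a + r)
    regroup q r = solve (A ∷ p ∷ a ∷ q ∷ r ∷ [])
    column : ∀ q → ∑[ r < p ] F (q * p + r) ≡ (p ∸ a) * [p∤ (A + q) C q ]
    column q = ∑-prefix-const (λ r → F (q * p + r)) (m∸n≤m p a) no-carry carry
      where
      no-carry : ∀ r → r < p ∸ a → F (q * p + r) ≡ [p∤ (A + q) C q ]
      no-carry r r<p∸a =
        trans (cong (λ n → [p∤ n C (q * p + r) ]) (regroup q r)) ([p∤C]-no-carry (A + q) q a+r<p)
        where a+r<p = subst (a + r <_) (m+[n∸m]≡n (<⇒≤ a<p)) (+-monoʳ-< a r<p∸a)
      carry : ∀ r → p ∸ a ≤ r → r < p → F (q * p + r) ≡ 0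
      carry r p∸a≤r r<p =
        trans (cong (λ n → [p∤ n C (q * p + r) ]) (regroup q r)) ([p∤C]-carry (A + q) q a<p r<p p≤a+r)
        where p≤a+r = subst (_≤ a + r) (m+[n∸m]≡n (<⇒≤ a<p)) (+-monoʳ-≤ a p∸a≤r)

  nonzeroCount-periodic : ∀ n a → nonzeroCount n (a + p ^ n) ≡ nonzeroCount n a
  nonzeroCount-periodic zero    a = refl
  nonzeroCount-periodic (suc n) a = begin
    nonzeroCount (suc n) (a + p * p ^ n)
      ≡⟨ cong (λ x → nonzeroCount (suc n) (x + p * p ^ n)) a≡a/p*p+a%p ⟩
    nonzeroCount (suc n) (a / p * p + a % p + p * p ^ n)
      ≡⟨ cong (nonzeroCount (suc n)) (add-to-high-digits (a / p) (a % p) (p ^ n) p) ⟩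
    nonzeroCount (suc n) ((a / p + p ^ n) * p + a % p)
      ≡⟨ nonzeroCount-digit n (a / p + p ^ n) (m%n<n a p) ⟩
    (p ∸ a % p) * nonzeroCount n (a / p + p ^ n)
      ≡⟨ cong ((p ∸ a % p) *_) (nonzeroCount-periodic n (a / p)) ⟩
    (p ∸ a % p) * nonzeroCount n (a / p)
      ≡⟨ nonzeroCount-digit n (a / p) (m%n<n a p) ⟨
    nonzeroCount (suc n) (a / p * p + a % p)
      ≡⟨ cong (nonzeroCount (suc n)) a≡a/p*p+a%p ⟨
    nonzeroCount (suc n) a
      ∎
    where
    a≡a/p*p+a%p : a ≡ a / p * p + a % p
    a≡a/p*p+a%p = trans (m≡m%n+[m/n]*n a p) (+-comm (a % p) (a / p * p))
    add-to-high-digits : ∀ x y z w → x * w + y + w * z ≡ (x + z) * w + y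
    add-to-high-digits = solve-∀

  nonzeroTotal : ℕ → ℕ
  nonzeroTotal n = ∑ (p ^ n) (nonzeroCount n)

  nonzeroTotal-suc : ∀ n → nonzeroTotal (suc n) ≡ (∑[ r < p ] (p ∸ r)) * nonzeroTotal n
  nonzeroTotal-suc n = begin
    ∑ (p * p ^ n) (nonzeroCount (suc n))
      ≡⟨ cong (λ m → ∑ m (nonzeroCount (suc n))) (*-comm p (p ^ n)) ⟩
    ∑ (p ^ n * p) (nonzeroCount (suc n))
      ≡⟨ ∑-* (p ^ n) p (nonzeroCount (suc n)) ⟩
    ∑[ q < p ^ n ] ∑[ r < p ] nonzeroCount (suc n) (q * p + r)
      ≡⟨ ∑-cong (p ^ n) (λ q _ → ∑-cong p (λ r r<p → nonzeroCount-digit n q r<p)) ⟩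
    ∑[ q < p ^ n ] ∑[ r < p ] ((p ∸ r) * nonzeroCount n q)
      ≡⟨ ∑-cong (p ^ n) (λ q _ → ∑-*ʳ p (nonzeroCount n q) (λ r → p ∸ r)) ⟩
    ∑[ q < p ^ n ] ((∑[ r < p ] (p ∸ r)) * nonzeroCount n q)
      ≡⟨ ∑-*ˡ (p ^ n) (∑[ r < p ] (p ∸ r)) (nonzeroCount n) ⟩
    (∑[ r < p ] (p ∸ r)) * nonzeroTotal n
      ∎

  2ⁿ*nonzeroTotal≡pⁿ*[p+1]ⁿ : ∀ n → 2 ^ n * nonzeroTotal n ≡ p ^ n * (p + 1) ^ n
  2ⁿ*nonzeroTotal≡pⁿ*[p+1]ⁿ zero    = cong (λ v → 1 * (v + 0 + 0)) ([p∤]-∤ p∤1)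
  2ⁿ*nonzeroTotal≡pⁿ*[p+1]ⁿ (suc n) = begin
    2 * 2 ^ n * nonzeroTotal (suc n)               ≡⟨ cong (2 * 2 ^ n *_) (nonzeroTotal-suc n) ⟩
    2 * 2 ^ n * (T * nonzeroTotal n)               ≡⟨ *-interchange 2 (2 ^ n) T (nonzeroTotal n) ⟩
    2 * T * (2 ^ n * nonzeroTotal n)               ≡⟨ cong₂ _*_ (2*∑[n∸i]≡n*[n+1] p)
                                                                 (2ⁿ*nonzeroTotal≡pⁿ*[p+1]ⁿ n) ⟩
    p * (p + 1) * (p ^ n * (p + 1) ^ n)            ≡⟨ *-interchange p (p + 1) (p ^ n) ((p + 1) ^ n) ⟩
    p * p ^ n * ((p + 1) * (p + 1) ^ n)            ∎
    where
    T : ℕ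
    T = ∑[ r < p ] (p ∸ r)

  [_≡p∸1] : ℕ → ℕ
  [ v ≡p∸1] = if does (v ≟ p ∸ 1) then 1 else 0

  [x∸1%p≡p∸1]+[p∤x]≡1 : ∀ {x} → 0 < x → [ (x ∸ 1) % p ≡p∸1] + [p∤ x ] ≡ 1
  [x∸1%p≡p∸1]+[p∤x]≡1 {suc y} _ with p ∣? suc y
  ... | yes p∣1+y = cong₂ _+_ (cong (if_then 1 else 0) (dec-true (y % p ≟ p ∸ 1) y%p≡p∸1)) ([p∤]-∣ p∣1+y)
    where y%p≡p∸1 = %-pred-≡0 {y} {p} (n∣m⇒m%n≡0 (suc y) p p∣1+y)
  ... | no  p∤1+y = cong₂ _+_ (cong (if_then 1 else 0) (dec-false (y % p ≟ p ∸ 1) y%p≢p∸1)) ([p∤]-∤ p∤1+y)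
    where y%p≢p∸1 = λ y%p≡p∸1 → p∤1+y (m%n≡0⇒n∣m (suc y) p (m%n≡n∸1⇒[1+m]%n≡0 y p y%p≡p∸1))

  topCount : ℕ → ℕ → ℕ → ℕ
  topCount L R n = ∑[ r < R ] ∑[ j < p ^ n ] [ entry p (L + r) j ≡p∸1]

  topCount+nonzeroCount≡R*pⁿ : ∀ L R n → topCount L R n + ∑[ r < R ] nonzeroCount n (L + r + 1) ≡ R * p ^ n
  topCount+nonzeroCount≡R*pⁿ L R n = begin
    topCount L R n + ∑[ r < R ] nonzeroCount n (L + r + 1)    ≡⟨ ∑-distrib-+ R _ _ ⟨
    ∑[ r < R ] (top (L + r) + nonzeroCount n (L + r + 1))     ≡⟨ ∑-cong R (λ r _ → row (L + r)) ⟩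
    ∑[ _ < R ] (p ^ n)                                        ≡⟨ ∑-const R (p ^ n) ⟩
    R * p ^ n                                                 ∎
    where
    top : ℕ → ℕ
    top i = ∑[ j < p ^ n ] [ entry p i j ≡p∸1]
    row : ∀ i → top i + nonzeroCount n (i + 1) ≡ p ^ n
    row i = begin
      top i + nonzeroCount n (i + 1)
        ≡⟨ ∑-distrib-+ (p ^ n) _ _ ⟨
      ∑[ j < p ^ n ] ([ entry p i j ≡p∸1] + [p∤ (i + 1 + j) C j ])
        ≡⟨ ∑-cong (p ^ n) (λ j _ → [x∸1%p≡p∸1]+[p∤x]≡1 (nCk>0 (m≤n+m j (i + 1)))) ⟩
      ∑[ _ < p ^ n ] 1
        ≡⟨ ∑-const (p ^ n) 1 ⟩
      p ^ n * 1
        ≡⟨ *-identityʳ (p ^ n) ⟩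
      p ^ n
        ∎

  topCount-multiple : ∀ L c n → topCount L (c * p ^ n) n + c * nonzeroTotal n ≡ c * p ^ n * p ^ n
  topCount-multiple L c n = begin
    topCount L (c * p ^ n) n + c * nonzeroTotal n
      ≡⟨ cong (topCount L (c * p ^ n) n +_) window ⟨
    topCount L (c * p ^ n) n + ∑[ r < c * p ^ n ] nonzeroCount n (L + r + 1)
      ≡⟨ topCount+nonzeroCount≡R*pⁿ L (c * p ^ n) n ⟩
    c * p ^ n * p ^ n
      ∎
    where
    window : ∑[ r < c * p ^ n ] nonzeroCount n (L + r + 1) ≡ c * nonzeroTotal n
    window = trans (∑-cong (c * p ^ n) (λ r _ → cong (nonzeroCount n) (+-right-comm L r 1)))
                   (∑-periodic-window c (p ^ n) (nonzeroCount n) (nonzeroCount-periodic n) (L + 1))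

complement-identity : ∀ {x t c P N E e} → E ≡ e * P → x + c * t ≡ c * P * P → e * t ≡ P * N →
                      x * E + N * (c * P * P) ≡ E * (c * P * P)
complement-identity {x} {t} {c} {P} {N} {_} {e} refl x+ct≡cPP et≡PN = begin
  x * (e * P) + N * (c * P * P)       ≡⟨ solve (x ∷ c ∷ P ∷ N ∷ e ∷ []) ⟩
  e * P * x + c * P * (P * N)         ≡⟨ cong (λ y → e * P * x + c * P * y) et≡PN ⟨
  e * P * x + c * P * (e * t)         ≡⟨ solve (x ∷ t ∷ c ∷ P ∷ e ∷ []) ⟩
  e * P * (x + c * t)                 ≡⟨ cong (e * P *_) x+ct≡cPP ⟩
  e * P * (c * P * P)                 ∎

lemma6 : (p : ℕ) → (pr : Prime p) → (m : ℕ) → 7 < m →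
             ratio (countTop p {{prime⇒nonZero pr}} m) (numRows p m * numCols p m)
               ≡ 1ℚ - ratio ((p + 1) ^ (m ∸ 7)) ((2 * p) ^ (m ∸ 7))
lemma6 p pr m@(suc (suc (suc (suc (suc (suc (suc n))))))) (s≤s (s≤s (s≤s (s≤s (s≤s (s≤s (s≤s _))))))) =
  ratio-complement rows*cols>0 (m^n>0 (2 * p) {{m*n≢0 2 p}} n) identity
  where
  open PrimeModulus pr
  c : ℕ
  c = p * (p ^ 3 ∸ 1)
  rows : numRows p m ≡ c * p ^ n
  rows = m∸[m∸n]≡n (≤-trans (*-monoˡ-≤ (p ^ n) (*-monoʳ-≤ p (m∸n≤m (p ^ 3) 1)))
                            (≤-reflexive (sym (^-distribˡ-+-* p 4 n))))
  rows*cols>0 : 0 < numRows p m * numCols p m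
  rows*cols>0 rewrite rows = *-mono-≤ (*-mono-≤ c>0 (m^n>0 p n)) (m^n>0 p n)
    where c>0 = *-mono-≤ (>-nonZero⁻¹ p) (m<n⇒0<n∸m (*-mono-≤ 1<p (m^n>0 p 2)))
  countTop≡topCount : countTop p m ≡ topCount (rowLo p m) (numRows p m) n
  countTop≡topCount =
    trans (sum-map-upTo _ (numRows p m)) (∑-cong (numRows p m) (λ r _ → sum-map-upTo _ (p ^ n)))
  identity : countTop p m * (2 * p) ^ n + (p + 1) ^ n * (numRows p m * numCols p m)
               ≡ (2 * p) ^ n * (numRows p m * numCols p m)
  identity rewrite countTop≡topCount | rows =
    complement-identity {t = nonzeroTotal n} {c = c} {P = p ^ n} {e = 2 ^ n}
      ([m*n]^o≡m^o*n^o 2 p n) (topCount-multiple (rowLo p m) c n) (2ⁿ*nonzeroTotal≡pⁿ*[p+1]ⁿ n)
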